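{- Let $G_0$ be a finite undirected simple graph and $P$ a finite poset. There exists an orientation $G'$ of $G_0$ whose edges (2-walks) are $P$-colorable if and only if $\chi(G_0)\le |A(P)|$. Moreover, when $\chi(G_0)\le|A(P)|$, such an orientation $G'$ can be chosen to be acyclic.
   Context: An orientation of $G_0$ is a digraph on the same vertex set obtained by replacing each edge $\{u,v\}$ of $G_0$ by exactly one of the directed edges $u\to v$, $v\to u$. A 2-walk of a digraph is a pair $(v_1v_2)$ with $v_1\to v_2$; a 3-walk is $(v_1v_2v_3)$ with $v_1\to v_2\to v_3$. A $P$-coloring of the 2-walks is a map $c$ from edges to $P$ with $c(v_1v_2)\not\le c(v_2v_3)$ for every 3-walk $(v_1v_2v_3)$. $A(P)$ is the set of all antichains of $P$ (including the empty one). $\chi(G_0)$ is the chromatic number of $G_0$. -}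

module Defs where

open import Level using (0ℓ)
open import Data.Nat using (ℕ; zero; suc)
open import Data.Bool using (Bool; true; false)
open import Data.Fin using (Fin)
open import Data.Fin.Properties using (all?; _≟_)
open import Data.Fin.Subset using (Subset; _∈_)
open import Data.Fin.Subset.Properties using (_∈?_)
open import Data.Vec using (_∷_; [])
open import Data.List using (List; _∷_; []; _++_; map; filter; length)
open import Data.Product using (Σ; ∃; _×_; _,_)
open import Data.Sum using (_⊎_)
open import Data.Empty using (⊥)
open import Relation.Nullary using (¬_; Dec; yes; no)
open import Relation.Nullary.Decidable using (_→-dec_)
open import Relation.Binary using (Rel; Decidable)
open import Relation.Binary.PropositionalEquality using (_≡_; _≢_)
open import Relation.Binary.Construct.Closure.Transitive using (TransClosure)

-- A finite graph on vertex set Fin n is given by an adjacency relation E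
-- (simplicity = symmetric + irreflexive, imposed in the theorem).

Colorable : ∀ {n} → Rel (Fin n) 0ℓ → ℕ → Set
Colorable {n} E k = Σ (Fin n → Fin k) λ f → ∀ u v → E u v → f u ≢ f v

IsChromaticNumber : ∀ {n} → Rel (Fin n) 0ℓ → ℕ → Set
IsChromaticNumber E c = Colorable E c × (∀ k → Colorable E k → c Data.Nat.≤ k)

IsOrientation : ∀ {n} → Rel (Fin n) 0ℓ → Rel (Fin n) 0ℓ → Set
IsOrientation {n} E D =
  (∀ u v → D u v → E u v) ×
  (∀ u v → E u v → (D u v ⊎ D v u) × ¬ (D u v × D v u))

Acyclic : ∀ {n} → Rel (Fin n) 0ℓ → Set
Acyclic {n} D = ∀ (v : Fin n) → ¬ TransClosure D v v

-- P-colouring of the 2-walks (arcs) of D, where P = (Fin m, _≤P_):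
-- c(v1v2) ≰ c(v2v3) for every 3-walk v1 → v2 → v3.
PColorable : ∀ {n m} → Rel (Fin n) 0ℓ → Rel (Fin m) 0ℓ → Set
PColorable {n} {m} D _≤P_ =
  Σ (∀ (u v : Fin n) → D u v → Fin m) λ c →
    ∀ u v w (p : D u v) (q : D v w) → ¬ (c u v p ≤P c v w q)

allSubsets : (m : ℕ) → List (Subset m)
allSubsets zero = [] ∷ []
allSubsets (suc m) = map (true ∷_) (allSubsets m) ++ map (false ∷_) (allSubsets m)

IsAntichain : ∀ {m} → Rel (Fin m) 0ℓ → Subset m → Set
IsAntichain _≤P_ S = ∀ x y → x ∈ S → y ∈ S → x ≤P y → x ≡ y

isAntichain? : ∀ {m} (_≤P_ : Rel (Fin m) 0ℓ) → Decidable _≤P_ →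
               (S : Subset m) → Dec (IsAntichain _≤P_ S)
isAntichain? _≤P_ _≤?_ S =
  all? λ x → all? λ y →
    (x ∈? S) →-dec ((y ∈? S) →-dec ((x ≤? y) →-dec (x ≟ y)))

-- |A(P)|: number of antichains (including the empty one).
numAntichains : ∀ {m} (_≤P_ : Rel (Fin m) 0ℓ) → Decidable _≤P_ → ℕ
numAntichains {m} _≤P_ dec = length (filter (isAntichain? _≤P_ dec) (allSubsets m))

{-# OPTIONS --safe #-}
module Submission where

-- Both directions pass through proper vertex colourings by antichains of P.
-- Given a P-colouring of the arcs of an orientation, colour v by the antichain of
-- minimal colours of arcs entering v. For an arc v → w take a minimal entering colour
-- z ≤ c(vw) at w; were the antichains at v and w equal, z = c(uv) for an arc u → v,
-- and c(uv) ≤ c(vw) would contradict the colouring.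
-- Conversely, given a proper colouring by antichains A(v), orient every edge towards
-- the endpoint whose up-set ↑A(v) is larger (ties broken by the vertex), which is
-- acyclic. Distinct antichains have distinct up-sets, so along an arc u → v some
-- x ∈ ↑A(v) ∖ ↑A(u) exists; colour the arc by it. On a 3-walk u → v → w,
-- c(uv) ∈ ↑A(v) and c(vw) ∉ ↑A(v), so c(uv) ≰ c(vw) because up-sets are up-closed.

open import Defs
open import Level using (0ℓ)
open import Data.Nat using (ℕ; _≤_)
open import Data.Fin using (Fin)
open import Data.Product using (Σ; _×_)
open import Relation.Binary using (Rel; Decidable; Symmetric; Irreflexive; IsPartialOrder)
open import Relation.Binary.PropositionalEquality using (_≡_)

open import Function using (_∘_)
open import Data.Bool using (true; false)
import Data.Nat as ℕ
import Data.Nat.Properties as ℕ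
open import Data.Fin using (zero; suc; inject≤)
import Data.Fin as Fin using (_<_)
import Data.Fin.Properties as Fin
open import Data.Fin.Subset using (Subset; _∈_; _∉_; _⊆_; ∣_∣)
open import Data.Fin.Subset.Properties using (_∈?_; _⊆?_; ⊆-antisym; p⊂q⇒∣p∣<∣q∣)
open import Data.Vec using ([]; _∷_; tabulate) renaming (lookup to lookupᵛ)
open import Data.Vec.Properties using (lookup∘tabulate; lookup⇒[]=; []=⇒lookup; ∷-injectiveʳ)
open import Data.List using (List; map; filter; lookup)
open import Data.List.Membership.Propositional using () renaming (_∈_ to _∈ₗ_)
open import Data.List.Membership.Propositional.Properties
  using (∈-++⁺ˡ; ∈-++⁺ʳ; ∈-map⁺; ∈-map⁻; ∈-filter⁺; ∈-filter⁻; ∈-lookup)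
open import Data.List.Relation.Unary.Any using (here; index)
open import Data.List.Relation.Unary.Any.Properties using (lookup-index)
import Data.List.Relation.Unary.All as All
open import Data.List.Relation.Unary.AllPairs using ([]; _∷_)
open import Data.List.Relation.Unary.Unique.Propositional using (Unique)
import Data.List.Relation.Unary.Unique.Propositional.Properties as Unique
open import Data.Product using (∃; _,_; proj₁; proj₂)
open import Data.Product.Relation.Binary.Lex.Strict using (×-Lex; ×-isStrictTotalOrder)
open import Data.Sum using (_⊎_; inj₁; inj₂)
open import Data.Empty using (⊥-elim)
open import Relation.Nullary using (¬_; Dec; yes; no; does; ¬?; contradiction)
open import Relation.Nullary.Decidable
  using (_×-dec_; _→-dec_; map′; dec-true; dec-false; decidable-stable; recompute)
open import Relation.Unary as U using (Pred)
open import Relation.Binary using (IsStrictTotalOrder; tri<; tri≈; tri>)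
open import Relation.Binary.PropositionalEquality using (refl; sym; trans; cong; subst; _≢_; module ≡-Reasoning)
open import Relation.Binary.Construct.Closure.Transitive using (TransClosure; [_]; _∷_)
open import Induction.WellFounded using (Acc; acc)
open import Data.Fin.Induction using (po-wellFounded)

module _ {m ℓ} {P : Pred (Fin m) ℓ} (P? : U.Decidable P) where

  toSubset : Subset m
  toSubset = tabulate (does ∘ P?)

  ∈-toSubset⁺ : ∀ {x} → P x → x ∈ toSubset
  ∈-toSubset⁺ {x} px = lookup⇒[]= x toSubset (trans (lookup∘tabulate _ x) (dec-true (P? x) px))

  ∈-toSubset⁻ : ∀ {x} → x ∈ toSubset → P x
  ∈-toSubset⁻ {x} x∈ = decidable-stable (P? x) λ ¬px → contradiction (begin
    true               ≡⟨ []=⇒lookup x∈ ⟨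
    lookupᵛ toSubset x ≡⟨ lookup∘tabulate _ x ⟩
    does (P? x)        ≡⟨ dec-false (P? x) ¬px ⟩
    false              ∎) λ ()
    where open ≡-Reasoning

module _ {m} {p q : Subset m} where

  p⊈q⇒∃∈p∉q : ¬ p ⊆ q → ∃ λ x → x ∈ p × x ∉ q
  p⊈q⇒∃∈p∉q p⊈q with Fin.any? (λ x → (x ∈? p) ×-dec ¬? (x ∈? q))
  ... | yes w = w
  ... | no ∄ = ⊥-elim (p⊈q λ {x} x∈p → decidable-stable (x ∈? q) λ x∉q → ∄ (x , x∈p , x∉q))

  ∣p∣≤∣q∣∧q⊆p⇒p≡q : ∣ p ∣ ≤ ∣ q ∣ → q ⊆ p → p ≡ q
  ∣p∣≤∣q∣∧q⊆p⇒p≡q ∣p∣≤∣q∣ q⊆p with p ⊆? q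
  ... | yes p⊆q = ⊆-antisym p⊆q q⊆p
  ... | no p⊈q = contradiction ∣p∣≤∣q∣ (ℕ.<⇒≱ (p⊂q⇒∣p∣<∣q∣ (q⊆p , p⊈q⇒∃∈p∉q p⊈q)))

∈-allSubsets : ∀ {m} (S : Subset m) → S ∈ₗ allSubsets m
∈-allSubsets [] = here refl
∈-allSubsets {ℕ.suc m} (true ∷ S) = ∈-++⁺ˡ (∈-map⁺ (true ∷_) (∈-allSubsets S))
∈-allSubsets {ℕ.suc m} (false ∷ S) =
  ∈-++⁺ʳ (map (true ∷_) (allSubsets m)) (∈-map⁺ (false ∷_) (∈-allSubsets S))

allSubsets-unique : ∀ m → Unique (allSubsets m)
allSubsets-unique ℕ.zero = All.[] ∷ []
allSubsets-unique (ℕ.suc m) =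
  Unique.++⁺ (Unique.map⁺ ∷-injectiveʳ (allSubsets-unique m))
             (Unique.map⁺ ∷-injectiveʳ (allSubsets-unique m))
             disjoint
  where
    disjoint : ∀ {S} → ¬ (S ∈ₗ map (true ∷_) (allSubsets m) × S ∈ₗ map (false ∷_) (allSubsets m))
    disjoint (S∈ₜ , S∈f) with ∈-map⁻ (true ∷_) S∈ₜ | ∈-map⁻ (false ∷_) S∈f
    ... | _ , _ , refl | _ , _ , ()

lookup-injective : ∀ {A : Set} {xs : List A} → Unique xs → ∀ i j → lookup xs i ≡ lookup xs j → i ≡ j
lookup-injective (_ ∷ _) zero zero _ = refl
lookup-injective (x∉xs ∷ _) zero (suc j) eq = contradiction eq (All.lookup x∉xs (∈-lookup j))
lookup-injective (x∉xs ∷ _) (suc i) zero eq = contradiction (sym eq) (All.lookup x∉xs (∈-lookup i))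
lookup-injective (_ ∷ xs-unique) (suc i) (suc j) eq = cong suc (lookup-injective xs-unique i j eq)

module _ {n} {E D : Rel (Fin n) 0ℓ} where

  orientation-decidable : IsOrientation E D → Decidable E → Decidable D
  orientation-decidable (D⊆E , orients) E? u v with E? u v
  ... | no ¬e = no (¬e ∘ D⊆E u v)
  ... | yes e with orients u v e
  ...   | inj₁ d , _ = yes d
  ...   | inj₂ d′ , not-both = no λ d → not-both (d , d′)

  orientation-proper : ∀ {A : Set} {f : Fin n → A} → IsOrientation E D →
                       (∀ {u v} → D u v → f u ≢ f v) → ∀ u v → E u v → f u ≢ f v
  orientation-proper (_ , orients) arc-proper u v e with orients u v e
  ... | inj₁ d , _ = arc-proper d
  ... | inj₂ d , _ = arc-proper d ∘ sym

module _ {n} {E : Rel (Fin n) 0ℓ} {A : Set} {_≈_ _<_ : Rel A 0ℓ}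
         (<-isStrictTotalOrder : IsStrictTotalOrder _≈_ _<_) (key : Fin n → A) where
  open IsStrictTotalOrder <-isStrictTotalOrder using (compare; asym; irrefl; module Eq) renaming (trans to <-trans)

  KeyOrientation : Rel (Fin n) 0ℓ
  KeyOrientation u v = E u v × key u < key v

  keyOrientation-isOrientation : Symmetric E → (∀ {u v} → E u v → ¬ key u ≈ key v) →
                                 IsOrientation E KeyOrientation
  keyOrientation-isOrientation sym-E key-separates =
    (λ _ _ → proj₁) , λ u v e → direction e , λ ((_ , u<v) , (_ , v<u)) → asym u<v v<u
    where
      direction : ∀ {u v} → E u v → KeyOrientation u v ⊎ KeyOrientation v u
      direction {u} {v} e with compare (key u) (key v)
      ... | tri< u<v _ _ = inj₁ (e , u<v)
      ... | tri≈ _ u≈v _ = contradiction u≈v (key-separates e)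
      ... | tri> _ _ v<u = inj₂ (sym-E e , v<u)

  keyOrientation-acyclic : Acyclic KeyOrientation
  keyOrientation-acyclic v v⁺v = irrefl Eq.refl (⁺⇒< v⁺v)
    where
      ⁺⇒< : ∀ {u w} → TransClosure KeyOrientation u w → key u < key w
      ⁺⇒< [ _ , u<w ] = u<w
      ⁺⇒< ((_ , u<v) ∷ v⁺w) = <-trans u<v (⁺⇒< v⁺w)

module _ {m} {_⊑_ : Rel (Fin m) 0ℓ} (⊑-isPartialOrder : IsPartialOrder _≡_ _⊑_)
         (_⊑?_ : Decidable _⊑_) where
  open IsPartialOrder ⊑-isPartialOrder using (antisym) renaming (refl to ⊑-refl; trans to ⊑-trans)

  antichains : List (Subset m)
  antichains = filter (isAntichain? _⊑_ _⊑?_) (allSubsets m)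

  antichains-unique : Unique antichains
  antichains-unique = Unique.filter⁺ (isAntichain? _⊑_ _⊑?_) (allSubsets-unique m)

  lookup-antichains-isAntichain : ∀ i → IsAntichain _⊑_ (lookup antichains i)
  lookup-antichains-isAntichain i =
    proj₂ (∈-filter⁻ (isAntichain? _⊑_ _⊑?_) {xs = allSubsets m} (∈-lookup i))

  antichainIndex : ∀ {S} → IsAntichain _⊑_ S → Fin (numAntichains _⊑_ _⊑?_)
  antichainIndex {S} S-antichain = index (∈-filter⁺ (isAntichain? _⊑_ _⊑?_) (∈-allSubsets S) S-antichain)

  lookup-antichainIndex : ∀ {S} (S-antichain : IsAntichain _⊑_ S) →
                          lookup antichains (antichainIndex S-antichain) ≡ S
  lookup-antichainIndex {S} S-antichain =
    sym (lookup-index (∈-filter⁺ (isAntichain? _⊑_ _⊑?_) (∈-allSubsets S) S-antichain))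

  module _ {S : Pred (Fin m) 0ℓ} (S? : U.Decidable S) where

    Minimal : Pred (Fin m) 0ℓ
    Minimal z = S z × (∀ y → S y → y ⊑ z → y ≡ z)

    minimal? : U.Decidable Minimal
    minimal? z = S? z ×-dec Fin.all? λ y → S? y →-dec (y ⊑? z) →-dec (y Fin.≟ z)

    minimals : Subset m
    minimals = toSubset minimal?

    minimals-isAntichain : IsAntichain _⊑_ minimals
    minimals-isAntichain x y x∈ y∈ =
      proj₂ (∈-toSubset⁻ minimal? y∈) x (proj₁ (∈-toSubset⁻ minimal? x∈))

    minimal-below : ∀ {x} → S x → ∃ λ z → Minimal z × z ⊑ x
    minimal-below {x} = go (po-wellFounded ⊑-isPartialOrder x)
      where
        go : ∀ {x} → Acc (λ y z → y ⊑ z × y ≢ z) x → S x → ∃ λ z → Minimal z × z ⊑ x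
        go {x} (acc below) sx with Fin.any? (λ y → S? y ×-dec (y ⊑? x) ×-dec ¬? (y Fin.≟ x))
        ... | yes (y , sy , y⊑x , y≢x) with go (below (y⊑x , y≢x)) sy
        ...   | z , z-minimal , z⊑y = z , z-minimal , ⊑-trans z⊑y y⊑x
        go {x} _ sx | no ∄ =
          x , (sx , λ y sy y⊑x → decidable-stable (y Fin.≟ x) λ y≢x → ∄ (y , sy , y⊑x , y≢x)) , ⊑-refl

  Above : Subset m → Pred (Fin m) 0ℓ
  Above A x = ∃ λ a → a ∈ A × a ⊑ x

  above? : ∀ A → U.Decidable (Above A)
  above? A x = Fin.any? λ a → (a ∈? A) ×-dec (a ⊑? x)

  upset : Subset m → Subset m
  upset A = toSubset (above? A)

  ∈-upset⁺ : ∀ {A a x} → a ∈ A → a ⊑ x → x ∈ upset A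
  ∈-upset⁺ {A} a∈A a⊑x = ∈-toSubset⁺ (above? A) (_ , a∈A , a⊑x)

  ∈-upset⁻ : ∀ {A x} → x ∈ upset A → Above A x
  ∈-upset⁻ {A} = ∈-toSubset⁻ (above? A)

  upset-upClosed : ∀ {A x y} → x ∈ upset A → x ⊑ y → y ∈ upset A
  upset-upClosed x∈ x⊑y with ∈-upset⁻ x∈
  ... | a , a∈A , a⊑x = ∈-upset⁺ a∈A (⊑-trans a⊑x x⊑y)

  upset-injective : ∀ {A B} → IsAntichain _⊑_ A → IsAntichain _⊑_ B → upset A ≡ upset B → A ≡ B
  upset-injective A-antichain B-antichain same =
    ⊆-antisym (antichain⊆ A-antichain same) (antichain⊆ B-antichain (sym same))
    where
      antichain⊆ : ∀ {A B} → IsAntichain _⊑_ A → upset A ≡ upset B → A ⊆ B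
      antichain⊆ {A} {B} A-antichain same {a} a∈A
        with ∈-upset⁻ (subst (a ∈_) same (∈-upset⁺ a∈A ⊑-refl))
      ... | b , b∈B , b⊑a with ∈-upset⁻ (subst (b ∈_) (sym same) (∈-upset⁺ b∈B ⊑-refl))
      ...   | a′ , a′∈A , a′⊑b with A-antichain a′ a a′∈A a∈A (⊑-trans a′⊑b b⊑a)
      ...     | refl = subst (_∈ B) (antisym b⊑a a′⊑b) b∈B

  AntichainColoring : ∀ {n} → Rel (Fin n) 0ℓ → Set
  AntichainColoring {n} E =
    Σ (Fin n → Subset m) λ g → (∀ v → IsAntichain _⊑_ (g v)) × (∀ u v → E u v → g u ≢ g v)

  module _ {n} {E : Rel (Fin n) 0ℓ} where

    antichainColoring⇒colorable : AntichainColoring E → Colorable E (numAntichains _⊑_ _⊑?_)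
    antichainColoring⇒colorable (g , g-antichain , g-proper) =
      (λ v → antichainIndex (g-antichain v)) , λ u v e same → g-proper u v e (begin
        g u                                                ≡⟨ lookup-antichainIndex (g-antichain u) ⟨
        lookup antichains (antichainIndex (g-antichain u)) ≡⟨ cong (lookup antichains) same ⟩
        lookup antichains (antichainIndex (g-antichain v)) ≡⟨ lookup-antichainIndex (g-antichain v) ⟩
        g v                                                ∎)
      where open ≡-Reasoning

    colorable⇒antichainColoring : ∀ {k} → k ≤ numAntichains _⊑_ _⊑?_ → Colorable E k →
                                  AntichainColoring E
    colorable⇒antichainColoring k≤ (f , f-proper) =
      g , (λ v → lookup-antichains-isAntichain (inject≤ (f v) k≤)) ,
      λ u v e same →
        f-proper u v e (Fin.inject≤-injective k≤ k≤ _ _ (lookup-injective antichains-unique _ _ same))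
      where
        g : Fin n → Subset m
        g v = lookup antichains (inject≤ (f v) k≤)

  module _ {n} {D : Rel (Fin n) 0ℓ} (D? : Decidable D) (c : ∀ u v → .(D u v) → Fin m) where

    Incoming : Fin n → Pred (Fin m) 0ℓ
    Incoming v x = ∃ λ u → Σ (D u v) λ p → c u v p ≡ x

    incoming? : ∀ v → U.Decidable (Incoming v)
    incoming? v x = Fin.any? from?
      where
        from? : ∀ u → Dec (Σ (D u v) λ p → c u v p ≡ x)
        from? u with D? u v
        -- c takes the arc irrelevantly, so every proof of D u v has the colour of p.
        ... | yes p = map′ (p ,_) proj₂ (c u v p Fin.≟ x)
        ... | no ¬p = no (¬p ∘ proj₁)

    minIncoming : Fin n → Subset m
    minIncoming v = minimals (incoming? v)

    minIncoming-arc : (∀ u v w (p : D u v) (q : D v w) → ¬ c u v p ⊑ c v w q) →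
                      ∀ {v w} → D v w → minIncoming v ≢ minIncoming w
    minIncoming-arc c-walk {v} {w} p same with minimal-below (incoming? w) (v , p , refl)
    ... | z , z-minimal , z⊑cvw
      with proj₁ (∈-toSubset⁻ (minimal? (incoming? v))
                    (subst (z ∈_) (sym same) (∈-toSubset⁺ (minimal? (incoming? w)) z-minimal)))
    ...   | u , q , refl = c-walk u v w q p z⊑cvw

  module _ {n} {E : Rel (Fin n) 0ℓ} where

    pColorable⇒antichainColoring : ∀ {D} → IsOrientation E D → Decidable E → PColorable D _⊑_ →
                                   AntichainColoring E
    pColorable⇒antichainColoring {D} orientation E? (c , c-walk) =
      minIncoming D? c′ ,
      (λ v → minimals-isAntichain (incoming? D? c′ v)) ,
      orientation-proper orientation (minIncoming-arc D? c′ c′-walk)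
      where
        D? : Decidable D
        D? = orientation-decidable orientation E?

        c′ : ∀ u v → .(D u v) → Fin m
        -- The colour of an arc now depends only on the arc, not on its proof.
        c′ u v p = c u v (recompute (D? u v) p)

        c′-walk : ∀ u v w (p : D u v) (q : D v w) → ¬ c′ u v p ⊑ c′ v w q
        c′-walk u v w p q = c-walk u v w _ _

    antichainColoring⇒acyclicPColorable :
      Symmetric E → Irreflexive _≡_ E → AntichainColoring E →
      Σ (Rel (Fin n) 0ℓ) λ D → IsOrientation E D × Acyclic D × PColorable D _⊑_
    antichainColoring⇒acyclicPColorable sym-E irrefl-E (g , g-antichain , g-proper) =
      D , keyOrientation-isOrientation lex key sym-E (λ e (_ , u≡v) → irrefl-E u≡v e) ,
      keyOrientation-acyclic lex key , (λ _ _ p → proj₁ (arc-witness p)) , witness-walk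
      where
        lex = ×-isStrictTotalOrder ℕ.<-isStrictTotalOrder Fin.<-isStrictTotalOrder

        key : Fin n → ℕ × Fin n
        key v = ∣ upset (g v) ∣ , v

        D : Rel (Fin n) 0ℓ
        D = KeyOrientation {E = E} lex key

        lex⇒≤ : ∀ {a b} {u v : Fin n} → ×-Lex _≡_ ℕ._<_ Fin._<_ (a , u) (b , v) → a ≤ b
        lex⇒≤ (inj₁ a<b) = ℕ.<⇒≤ a<b
        lex⇒≤ (inj₂ (refl , _)) = ℕ.≤-refl

        arc-witness : ∀ {u v} → D u v → ∃ λ x → x ∈ upset (g v) × x ∉ upset (g u)
        arc-witness {u} {v} (e , key-u<key-v) = p⊈q⇒∃∈p∉q λ ↑gv⊆↑gu →
          g-proper u v e (upset-injective (g-antichain u) (g-antichain v)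
                           (∣p∣≤∣q∣∧q⊆p⇒p≡q (lex⇒≤ key-u<key-v) ↑gv⊆↑gu))

        witness-walk : ∀ u v w (p : D u v) (q : D v w) → ¬ proj₁ (arc-witness p) ⊑ proj₁ (arc-witness q)
        witness-walk u v w p q x⊑y with arc-witness p | arc-witness q
        ... | x , x∈↑gv , _ | y , _ , y∉↑gv = y∉↑gv (upset-upClosed x∈↑gv x⊑y)

mainTheorem12 : (n : ℕ) (E : Rel (Fin n) 0ℓ) → Symmetric E → Irreflexive _≡_ E → Decidable E →
                (m : ℕ) (_≤P_ : Rel (Fin m) 0ℓ) → IsPartialOrder _≡_ _≤P_ → (dec : Decidable _≤P_) →
                (χ : ℕ) → IsChromaticNumber E χ →
                ((Σ (Rel (Fin n) 0ℓ) λ D → IsOrientation E D × PColorable D _≤P_) → χ ≤ numAntichains _≤P_ dec)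
                × (χ ≤ numAntichains _≤P_ dec → Σ (Rel (Fin n) 0ℓ) λ D → IsOrientation E D × Acyclic D × PColorable D _≤P_)
mainTheorem12 n E sym-E irrefl-E E? m _≤P_ ≤P-isPartialOrder _≤P?_ χ (χ-colorable , χ-least) =
  (λ (D , orientation , pColorable) →
     χ-least _ (antichainColoring⇒colorable ≤P-isPartialOrder _≤P?_
                 (pColorable⇒antichainColoring ≤P-isPartialOrder _≤P?_ orientation E? pColorable))) ,
  (λ χ≤ → antichainColoring⇒acyclicPColorable ≤P-isPartialOrder _≤P?_ sym-E irrefl-E
            (colorable⇒antichainColoring ≤P-isPartialOrder _≤P?_ χ≤ χ-colorable))
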